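{- Let $G$ be a factorable graph. If two vertices $a$ and $d$ are adjacent in $G$, then there exist vertices $b$ and $c$ adjacent in $G$ such that $a,b,c,d$ are pairwise distinct and $\deg_G(a)\deg_G(d)=\deg_G(b)\deg_G(c)$.
   Context: All graphs are finite, simple and undirected, without isolated vertices. A graph $G$ is factorable if there exist graphs $H,K$ on the vertex set $V(G)$ with $A=BC$, where $A,B,C$ are the adjacency matrices of $G,H,K$ with respect to one common ordering of the vertices. -}

module Defs where

open import Data.Nat using (ℕ; zero; suc; _+_; _*_)
open import Data.Fin using (Fin; zero; suc)
open import Data.Bool using (Bool; true; false)
open import Data.Product using (Σ; ∃; _×_; _,_)
open import Relation.Binary.PropositionalEquality using (_≡_; _≢_)

Σ[_] : (n : ℕ) → (Fin n → ℕ) → ℕ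
Σ[ zero ] f = 0
Σ[ suc n ] f = f zero + Σ[ n ] (λ i → f (suc i))

𝟙 : Bool → ℕ
𝟙 true = 1
𝟙 false = 0

-- A finite simple graph on vertex set Fin n, given by its adjacency relation,
-- without isolated vertices (standing convention of the paper).
record Graph (n : ℕ) : Set where
  field
    adj       : Fin n → Fin n → Bool
    symmetric : ∀ i j → adj i j ≡ adj j i
    loopless  : ∀ i → adj i i ≡ false
    noIsolated : ∀ i → ∃ λ j → adj i j ≡ true
open Graph public

adjMat : ∀ {n} → Graph n → Fin n → Fin n → ℕ
adjMat G i j = 𝟙 (adj G i j)

_⊗_ : ∀ {n} → (Fin n → Fin n → ℕ) → (Fin n → Fin n → ℕ) → Fin n → Fin n → ℕ
_⊗_ {n} B C i j = Σ[ n ] (λ k → B i k * C k j)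

Factorable : ∀ {n} → Graph n → Set
Factorable {n} G = Σ (Graph n) λ H → Σ (Graph n) λ K →
  ∀ i j → adjMat G i j ≡ (adjMat H ⊗ adjMat K) i j

deg : ∀ {n} → Graph n → Fin n → ℕ
deg {n} G i = Σ[ n ] (λ j → adjMat G i j)

-- Transposing A = BC gives A = CB, so H and K commute as matrices, and since A is a
-- 0/1 matrix every entry of CB is at most 1. Counting walks of length 3 from
-- the ends of an H-edge i k then shows deg_K k ≤ deg_K i, so deg_K is constant along
-- H-edges and deg_H along K-edges; in particular deg_G = deg_H · deg_K. An edge a d of
-- G lies on an H-K-path a b d and on a K-H-path a c d, and b c is an edge of G through
-- b a c. Moving the degree factors along these four edges turns
-- deg_G a · deg_G d into deg_G b · deg_G c.
module Submission where

open import Defs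
open import Data.Nat using (ℕ; zero; suc; _*_; _+_; _≤_; z≤n; s≤s)
open import Data.Nat.Properties
open import Data.Nat.Tactic.RingSolver using (solve-∀)
open import Data.Fin using (Fin; zero; suc)
open import Data.Bool using (Bool; true; false)
open import Data.Product using (∃; _×_; _,_)
open import Relation.Binary.PropositionalEquality
open import Algebra.Properties.Semiring.Sum +-*-semiring using (sum; sum-cong-≗; ∑-comm)
open import Algebra.Properties.CommutativeSemigroup *-commutativeSemigroup using (x∙yz≈y∙xz)

Σ-cong : ∀ n {f g : Fin n → ℕ} → (∀ i → f i ≡ g i) → Σ[ n ] f ≡ Σ[ n ] g
Σ-cong zero    f≗g = refl
Σ-cong (suc n) f≗g = cong₂ _+_ (f≗g zero) (Σ-cong n (λ i → f≗g (suc i)))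

Σ≡sum : ∀ n (f : Fin n → ℕ) → Σ[ n ] f ≡ sum f
Σ≡sum zero    f = refl
Σ≡sum (suc n) f = cong (f zero +_) (Σ≡sum n (λ i → f (suc i)))

Σ-comm : ∀ m n (f : Fin m → Fin n → ℕ) →
  Σ[ m ] (λ i → Σ[ n ] (f i)) ≡ Σ[ n ] (λ j → Σ[ m ] (λ i → f i j))
Σ-comm m n f = begin
  Σ[ m ] (λ i → Σ[ n ] (f i))          ≡⟨ Σ≡sum m _ ⟩
  sum (λ i → Σ[ n ] (f i))             ≡⟨ sum-cong-≗ (λ i → Σ≡sum n (f i)) ⟩
  sum (λ i → sum (f i))                ≡⟨ ∑-comm f ⟩
  sum (λ j → sum (λ i → f i j))        ≡⟨ sum-cong-≗ (λ j → Σ≡sum m (λ i → f i j)) ⟨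
  sum (λ j → Σ[ m ] (λ i → f i j))     ≡⟨ Σ≡sum n _ ⟨
  Σ[ n ] (λ j → Σ[ m ] (λ i → f i j))  ∎
  where open ≡-Reasoning

*-distribˡ-Σ : ∀ n c (f : Fin n → ℕ) → c * Σ[ n ] f ≡ Σ[ n ] (λ i → c * f i)
*-distribˡ-Σ zero    c f = *-zeroʳ c
*-distribˡ-Σ (suc n) c f =
  trans (*-distribˡ-+ c (f zero) _) (cong (c * f zero +_) (*-distribˡ-Σ n c (λ i → f (suc i))))

Σ-mono-≤ : ∀ n {f g : Fin n → ℕ} → (∀ i → f i ≤ g i) → Σ[ n ] f ≤ Σ[ n ] g
Σ-mono-≤ zero    f≤g = z≤n
Σ-mono-≤ (suc n) f≤g = +-mono-≤ (f≤g zero) (Σ-mono-≤ n (λ i → f≤g (suc i)))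

f≤Σf : ∀ n (f : Fin n → ℕ) k → f k ≤ Σ[ n ] f
f≤Σf (suc n) f zero    = m≤m+n (f zero) _
f≤Σf (suc n) f (suc k) = ≤-trans (f≤Σf n (λ i → f (suc i)) k) (m≤n+m _ (f zero))

Σ-positive : ∀ n (f : Fin n → ℕ) → 1 ≤ Σ[ n ] f → ∃ λ k → 1 ≤ f k
Σ-positive (suc n) f 1≤Σf with f zero in f₀≡
... | suc _ = zero , subst (1 ≤_) (sym f₀≡) (s≤s z≤n)
... | zero  with Σ-positive n (λ i → f (suc i)) 1≤Σf
...   | k , 1≤fk = suc k , 1≤fk

Mat : ℕ → Set
Mat n = Fin n → Fin n → Bool

⟦_⟧ : ∀ {n} → Mat n → Fin n → Fin n → ℕ
⟦ x ⟧ i j = 𝟙 (x i j)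

rowSum : ∀ {n} → Mat n → Fin n → ℕ
rowSum {n} x i = Σ[ n ] (⟦ x ⟧ i)

Symmetric : ∀ {n} → Mat n → Set
Symmetric x = ∀ i j → x i j ≡ x j i

𝟙*𝟙≡1 : ∀ {a b} → a ≡ true → b ≡ true → 𝟙 a * 𝟙 b ≡ 1
𝟙*𝟙≡1 refl refl = refl

𝟙*𝟙-positive : ∀ a b → 1 ≤ 𝟙 a * 𝟙 b → a ≡ true × b ≡ true
𝟙*𝟙-positive true  true  _ = refl , refl
𝟙*𝟙-positive true  false ()
𝟙*𝟙-positive false b     ()

path⇒⊗-positive : ∀ {n} (x y : Mat n) {i k j} → x i k ≡ true → y k j ≡ true →
  1 ≤ (⟦ x ⟧ ⊗ ⟦ y ⟧) i j
path⇒⊗-positive {n} x y {i} {k} {j} xik yjk =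
  ≤-trans (≤-reflexive (sym (𝟙*𝟙≡1 xik yjk))) (f≤Σf n (λ l → ⟦ x ⟧ i l * ⟦ y ⟧ l j) k)

⊗-positive⇒path : ∀ {n} (x y : Mat n) {i j} → 1 ≤ (⟦ x ⟧ ⊗ ⟦ y ⟧) i j →
  ∃ λ k → x i k ≡ true × y k j ≡ true
⊗-positive⇒path {n} x y {i} {j} positive with Σ-positive n _ positive
... | k , 1≤xy = k , 𝟙*𝟙-positive (x i k) (y k j) 1≤xy

⊗-transpose : ∀ {n} {x y : Mat n} → Symmetric x → Symmetric y →
  ∀ i j → (⟦ x ⟧ ⊗ ⟦ y ⟧) i j ≡ (⟦ y ⟧ ⊗ ⟦ x ⟧) j i
⊗-transpose {n} {x} {y} x-sym y-sym i j = Σ-cong n λ k →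
  trans (cong₂ (λ u v → 𝟙 u * 𝟙 v) (x-sym i k) (y-sym k j)) (*-comm (⟦ x ⟧ k i) (⟦ y ⟧ j k))

rowSum-⊗ : ∀ {n} (x y : Mat n) i →
  Σ[ n ] ((⟦ x ⟧ ⊗ ⟦ y ⟧) i) ≡ Σ[ n ] (λ k → ⟦ x ⟧ i k * rowSum y k)
rowSum-⊗ {n} x y i = trans (Σ-comm n n _)
  (Σ-cong n (λ k → sym (*-distribˡ-Σ n (⟦ x ⟧ i k) (⟦ y ⟧ k))))

-- Double counting of the pairs (j , c) with y k j, x j c and y i c: every j with y k j
-- has such a c, since (yx) i j = (xy) i j ≥ 1 through the walk i →x k →y j, and every
-- c has at most one such j, since (yx) k c ≤ 1.
rowSum-≤-along : ∀ {n} (x y : Mat n) → Symmetric x →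
  (∀ i j → (⟦ x ⟧ ⊗ ⟦ y ⟧) i j ≡ (⟦ y ⟧ ⊗ ⟦ x ⟧) i j) →
  (∀ i j → (⟦ y ⟧ ⊗ ⟦ x ⟧) i j ≤ 1) →
  ∀ {i k} → x i k ≡ true → rowSum y k ≤ rowSum y i
rowSum-≤-along {n} x y x-sym xy≡yx yx≤1 {i} {k} xik = begin
  Σ[ n ] (λ j → ⟦ y ⟧ k j)                                        ≤⟨ Σ-mono-≤ n walk-through-i ⟩
  Σ[ n ] (λ j → ⟦ y ⟧ k j * Σ[ n ] (λ c → ⟦ y ⟧ i c * ⟦ x ⟧ c j))   ≡⟨ Σ-cong n (λ j → *-distribˡ-Σ n (⟦ y ⟧ k j) _) ⟩
  Σ[ n ] (λ j → Σ[ n ] (λ c → ⟦ y ⟧ k j * (⟦ y ⟧ i c * ⟦ x ⟧ c j))) ≡⟨ Σ-comm n n _ ⟩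
  Σ[ n ] (λ c → Σ[ n ] (λ j → ⟦ y ⟧ k j * (⟦ y ⟧ i c * ⟦ x ⟧ c j))) ≡⟨ Σ-cong n (λ c → Σ-cong n (regroup c)) ⟩
  Σ[ n ] (λ c → Σ[ n ] (λ j → ⟦ y ⟧ i c * (⟦ y ⟧ k j * ⟦ x ⟧ j c))) ≡⟨ Σ-cong n (λ c → *-distribˡ-Σ n (⟦ y ⟧ i c) _) ⟨
  Σ[ n ] (λ c → ⟦ y ⟧ i c * (⟦ y ⟧ ⊗ ⟦ x ⟧) k c)                   ≤⟨ Σ-mono-≤ n (λ c → *-monoʳ-≤ (⟦ y ⟧ i c) (yx≤1 k c)) ⟩
  Σ[ n ] (λ c → ⟦ y ⟧ i c * 1)                                    ≡⟨ Σ-cong n (λ c → *-identityʳ (⟦ y ⟧ i c)) ⟩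
  Σ[ n ] (λ c → ⟦ y ⟧ i c)                                        ∎
  where
  open ≤-Reasoning
  regroup : ∀ c j → ⟦ y ⟧ k j * (⟦ y ⟧ i c * ⟦ x ⟧ c j) ≡ ⟦ y ⟧ i c * (⟦ y ⟧ k j * ⟦ x ⟧ j c)
  regroup c j rewrite x-sym c j = x∙yz≈y∙xz (⟦ y ⟧ k j) (⟦ y ⟧ i c) (⟦ x ⟧ j c)
  walk-through-i : ∀ j → ⟦ y ⟧ k j ≤ ⟦ y ⟧ k j * (⟦ y ⟧ ⊗ ⟦ x ⟧) i j
  walk-through-i j with y k j in ykj
  ... | false = z≤n
  ... | true  = ≤-trans (path⇒⊗-positive x y xik ykj) (≤-reflexive (trans (xy≡yx i j) (sym (+-identityʳ _))))

rowSum-⊗-factor : ∀ {n} (x y : Mat n) → (∀ {i k} → x i k ≡ true → rowSum y i ≡ rowSum y k) →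
  ∀ i → Σ[ n ] ((⟦ x ⟧ ⊗ ⟦ y ⟧) i) ≡ rowSum x i * rowSum y i
rowSum-⊗-factor {n} x y y-const i = begin
  Σ[ n ] ((⟦ x ⟧ ⊗ ⟦ y ⟧) i)                ≡⟨ rowSum-⊗ x y i ⟩
  Σ[ n ] (λ k → ⟦ x ⟧ i k * rowSum y k)     ≡⟨ Σ-cong n constant-on-support ⟩
  Σ[ n ] (λ k → ⟦ x ⟧ i k * rowSum y i)     ≡⟨ Σ-cong n (λ k → *-comm (⟦ x ⟧ i k) _) ⟩
  Σ[ n ] (λ k → rowSum y i * ⟦ x ⟧ i k)     ≡⟨ *-distribˡ-Σ n (rowSum y i) (⟦ x ⟧ i) ⟨
  rowSum y i * rowSum x i                   ≡⟨ *-comm (rowSum y i) _ ⟩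
  rowSum x i * rowSum y i                   ∎
  where
  open ≡-Reasoning
  constant-on-support : ∀ k → ⟦ x ⟧ i k * rowSum y k ≡ ⟦ x ⟧ i k * rowSum y i
  constant-on-support k with x i k in xik
  ... | false = refl
  ... | true  = cong (_+ 0) (sym (y-const xik))

adjacent⇒distinct : ∀ {n} (G : Graph n) {i j} → adj G i j ≡ true → i ≢ j
adjacent⇒distinct G {i} gij refl with () ← trans (sym gij) (loopless G i)

module Factorization {n} (G H K : Graph n)
  (A≡BC : ∀ i j → adjMat G i j ≡ (adjMat H ⊗ adjMat K) i j) where

  HK≡KH : ∀ i j → (adjMat H ⊗ adjMat K) i j ≡ (adjMat K ⊗ adjMat H) i j
  HK≡KH i j = begin
    (adjMat H ⊗ adjMat K) i j  ≡⟨ A≡BC i j ⟨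
    adjMat G i j               ≡⟨ cong 𝟙 (symmetric G i j) ⟩
    adjMat G j i               ≡⟨ A≡BC j i ⟩
    (adjMat H ⊗ adjMat K) j i  ≡⟨ ⊗-transpose (symmetric H) (symmetric K) j i ⟩
    (adjMat K ⊗ adjMat H) i j  ∎
    where open ≡-Reasoning

  HK≤1 : ∀ i j → (adjMat H ⊗ adjMat K) i j ≤ 1
  HK≤1 i j with adj G i j | A≡BC i j
  ... | true  | 1≡HK = ≤-reflexive (sym 1≡HK)
  ... | false | 0≡HK = ≤-trans (≤-reflexive (sym 0≡HK)) z≤n

  KH≤1 : ∀ i j → (adjMat K ⊗ adjMat H) i j ≤ 1
  KH≤1 i j = subst (_≤ 1) (HK≡KH i j) (HK≤1 i j)

  degK-constant-along-H : ∀ {i k} → adj H i k ≡ true → deg K i ≡ deg K k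
  degK-constant-along-H hik = ≤-antisym
    (rowSum-≤-along (adj H) (adj K) (symmetric H) HK≡KH KH≤1 (trans (symmetric H _ _) hik))
    (rowSum-≤-along (adj H) (adj K) (symmetric H) HK≡KH KH≤1 hik)

  degH-constant-along-K : ∀ {i k} → adj K i k ≡ true → deg H i ≡ deg H k
  degH-constant-along-K kik = ≤-antisym
    (rowSum-≤-along (adj K) (adj H) (symmetric K) KH≡HK HK≤1 (trans (symmetric K _ _) kik))
    (rowSum-≤-along (adj K) (adj H) (symmetric K) KH≡HK HK≤1 kik)
    where
    KH≡HK : ∀ i j → (adjMat K ⊗ adjMat H) i j ≡ (adjMat H ⊗ adjMat K) i j
    KH≡HK i j = sym (HK≡KH i j)

  deg-factor : ∀ i → deg G i ≡ deg H i * deg K i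
  deg-factor i = trans (Σ-cong n (A≡BC i)) (rowSum-⊗-factor (adj H) (adj K) degK-constant-along-H i)

  adjacent⇒HK-path : ∀ {i j} → adj G i j ≡ true → ∃ λ k → adj H i k ≡ true × adj K k j ≡ true
  adjacent⇒HK-path {i} {j} gij =
    ⊗-positive⇒path (adj H) (adj K) (subst (1 ≤_) (A≡BC i j) (≤-reflexive (sym (cong 𝟙 gij))))

  adjacent⇒KH-path : ∀ {i j} → adj G i j ≡ true → ∃ λ k → adj K i k ≡ true × adj H k j ≡ true
  adjacent⇒KH-path {i} {j} gij = ⊗-positive⇒path (adj K) (adj H)
    (subst (1 ≤_) (trans (A≡BC i j) (HK≡KH i j)) (≤-reflexive (sym (cong 𝟙 gij))))

  HK-path⇒adjacent : ∀ {i k j} → adj H i k ≡ true → adj K k j ≡ true → adj G i j ≡ true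
  HK-path⇒adjacent {i} {k} {j} hik kkj with adj G i j | A≡BC i j
  ... | true  | _    = refl
  ... | false | 0≡HK with () ← subst (1 ≤_) (sym 0≡HK) (path⇒⊗-positive (adj H) (adj K) hik kkj)

  deg-square : ∀ {a b c d} → adj H a b ≡ true → adj K b d ≡ true → adj K a c ≡ true → adj H c d ≡ true →
    deg G a * deg G d ≡ deg G b * deg G c
  deg-square {a} {b} {c} {d} hab kbd kac hcd = begin
    deg G a * deg G d                          ≡⟨ cong₂ _*_ (deg-factor a) (deg-factor d) ⟩
    (deg H a * deg K a) * (deg H d * deg K d)
      ≡⟨ cong₂ _*_ (cong₂ _*_ (degH-constant-along-K kac) (degK-constant-along-H hab))
                   (cong₂ _*_ (sym (degH-constant-along-K kbd)) (sym (degK-constant-along-H hcd))) ⟩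
    (deg H c * deg K b) * (deg H b * deg K c)  ≡⟨ regroup (deg H c) (deg K b) (deg H b) (deg K c) ⟩
    (deg H b * deg K b) * (deg H c * deg K c)  ≡⟨ cong₂ _*_ (deg-factor b) (deg-factor c) ⟨
    deg G b * deg G c                          ∎
    where
    open ≡-Reasoning
    regroup : ∀ p q r s → (p * q) * (r * s) ≡ (r * q) * (p * s)
    regroup = solve-∀

mainTheorem12 : ∀ {n} (G : Graph n) → Factorable G →
    ∀ (a d : Fin n) → adj G a d ≡ true →
    ∃ λ (b : Fin n) → ∃ λ (c : Fin n) →
    adj G b c ≡ true ×
    a ≢ b × a ≢ c × a ≢ d × b ≢ c × b ≢ d × c ≢ d ×
    deg G a * deg G d ≡ deg G b * deg G c
mainTheorem12 G (H , K , A≡BC) a d gad with adjacent⇒HK-path gad | adjacent⇒KH-path gad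
  where open Factorization G H K A≡BC
... | b , hab , kbd | c , kac , hcd =
  b , c , gbc , adjacent⇒distinct H hab , adjacent⇒distinct K kac , adjacent⇒distinct G gad ,
  b≢c , adjacent⇒distinct K kbd , adjacent⇒distinct H hcd , deg-square hab kbd kac hcd
  where
  open Factorization G H K A≡BC
  gbc : adj G b c ≡ true
  gbc = HK-path⇒adjacent (trans (symmetric H b a) hab) kac
  b≢c : b ≢ c
  b≢c refl = adjacent⇒distinct G (HK-path⇒adjacent hab (trans (symmetric K b a) kac)) refl
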